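{- Let $A\in\mathcal{A}(1,1,1)$. Then $A$ is $2$-connected.
   Context: All graphs are finite and simple. A graph is $2$-connected if it has more than $2$ vertices and removing any single vertex leaves it connected. $\mathcal{A}(1,1,1)$ is the class of connected planar $3$-regular graphs whose vertices can be assigned colours $c_1,c_2,c_3$ (possibly among further unused colours) so that every vertex has exactly one neighbour of each of the colours $c_1,c_2,c_3$. -}

module Defs where

open import Data.Nat using (ℕ; zero; suc; _+_; _*_; _<_; _≤ᵇ_)
open import Data.Fin using (Fin; toℕ)
open import Data.Bool using (Bool; true; false; if_then_else_; _∧_)
open import Data.List using (List; map; allFin; upTo)
open import Data.Nat.ListAction using (sum)
open import Data.Bool.ListAction using (all)
open import Data.Product using (Σ; _×_; ∃-syntax)
open import Data.Unit using (⊤)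
open import Data.Sum using (_⊎_)
open import Relation.Nullary using (¬_)
open import Relation.Nullary.Decidable using (⌊_⌋)
open import Relation.Binary.PropositionalEquality using (_≡_; _≢_)
import Data.Nat as ℕ

record Graph : Set where
  field
    n      : ℕ
    adj    : Fin n → Fin n → Bool
    sym    : ∀ u v → adj u v ≡ adj v u
    irrefl : ∀ v → adj v v ≡ false
open Graph public

count : ∀ {k} → (Fin k → Bool) → ℕ
count {k} p = sum (map (λ i → if p i then 1 else 0) (allFin k))

degree : (G : Graph) → Fin (n G) → ℕ
degree G v = count (adj G v)

Cubic : Graph → Set
Cubic G = ∀ v → degree G v ≡ 3

data Walk (G : Graph) (P : Fin (n G) → Set) : Fin (n G) → Fin (n G) → Set where
  here : ∀ {u} → P u → Walk G P u u
  step : ∀ {u v w} → P u → adj G u v ≡ true → Walk G P v w → Walk G P u w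

Connected : Graph → Set
Connected G = (0 < n G) × (∀ u w → Walk G (λ _ → ⊤) u w)

-- 2-connected: more than 2 vertices and removing any single vertex leaves
-- the graph connected (the remaining graph is nonempty since n > 2)
TwoConnected : Graph → Set
TwoConnected G = (2 < n G) ×
  (∀ v u w → u ≢ v → w ≢ v → Walk G (λ x → x ≢ v) u w)

iter : ∀ {A : Set} → (A → A) → ℕ → A → A
iter f zero    x = x
iter f (suc k) x = f (iter f k x)

-- number of orbits of a permutation φ of Fin m: the number of darts that are
-- minimal (w.r.t. toℕ) in their orbit {φ^k d | k < m}
orbitCount : ∀ {m} → (Fin m → Fin m) → ℕ
orbitCount {m} φ = count (λ d → all (λ k → toℕ d ≤ᵇ toℕ (iter φ k d)) (upTo m))

-- A combinatorial (rotation-system) embedding of G with m darts, of genus 0,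
-- i.e. satisfying Euler's formula V - E + F = 2 (with m = 2E).
record SphericalEmbedding (G : Graph) (m : ℕ) : Set where
  field
    tail head   : Fin m → Fin (n G)
    dart-adj    : ∀ d → adj G (tail d) (head d) ≡ true
    dart-unique : ∀ d d' → tail d ≡ tail d' → head d ≡ head d' → d ≡ d'
    dart-exists : ∀ u v → adj G u v ≡ true → Σ (Fin m) λ d → (tail d ≡ u) × (head d ≡ v)
    α           : Fin m → Fin m
    α-invol     : ∀ d → α (α d) ≡ d
    α-tail      : ∀ d → tail (α d) ≡ head d
    σ σ⁻¹       : Fin m → Fin m
    σσ⁻¹        : ∀ d → σ (σ⁻¹ d) ≡ d
    σ⁻¹σ        : ∀ d → σ⁻¹ (σ d) ≡ d
    σ-tail      : ∀ d → tail (σ d) ≡ tail d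
    σ-cyclic    : ∀ d d' → tail d ≡ tail d' → ∃[ k ] iter σ k d ≡ d'
    euler       : 2 * (n G + orbitCount (λ d → σ (α d))) ≡ 4 + m

PlanarConnected : Graph → Set
PlanarConnected G = (∀ u v → adj G u v ≡ false) ⊎ Σ ℕ (SphericalEmbedding G)

colNbrs : (G : Graph) → (Fin (n G) → ℕ) → Fin (n G) → ℕ → ℕ
colNbrs G c v i = count (λ w → adj G v w ∧ ⌊ c w ℕ.≟ i ⌋)

InA111 : Graph → Set
InA111 G = Connected G × PlanarConnected G × Cubic G ×
  Σ (Fin (n G) → ℕ) λ c → Σ ℕ λ c₁ → Σ ℕ λ c₂ → Σ ℕ λ c₃ →
    (c₁ ≢ c₂) × (c₁ ≢ c₃) × (c₂ ≢ c₃) ×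
    (∀ v → (colNbrs G c v c₁ ≡ 1) × (colNbrs G c v c₂ ≡ 1) × (colNbrs G c v c₃ ≡ 1))

-- A perfect colouring forbids bridges.  Suppose a–v is the only edge leaving a vertex set S,
-- let N Y count the Y-coloured vertices of S and M X Y the ordered edges y z inside S with
-- c y = Y and c z = X.  Each vertex of S has exactly one neighbour of each colour X, which lies
-- in S unless it is the neighbour v of a; so M X Y = N Y, except that M (c v) (c a) + 1 = N (c a).
-- As M is symmetric with even diagonal, comparing with a third colour gives a contradiction.
-- In a cubic graph a cut vertex v would give such a bridge: if two neighbours x, y of v were
-- separated in G - v, their components would each contain a second neighbour of v, making
-- four.  So consecutive neighbours of v on a walk can be joined avoiding v.
module Submission where

open import Defs renaming (sym to adj-sym)
open import Data.Bool using (Bool; true; false; if_then_else_; _∧_; _∨_; not)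
import Data.Bool.Properties as Bool
open import Data.Empty using (⊥)
open import Data.Fin using (Fin; zero; suc; punchIn; fromℕ<)
open import Data.Fin.Properties using (any?; punchInᵢ≢i) renaming (_≟_ to _≟ᶠ_)
open import Data.List using ([]; _∷_; length; tabulate; map)
open import Data.List.Properties using (map-tabulate)
open import Data.List.Relation.Unary.All as All using (All; []; _∷_)
open import Data.List.Relation.Unary.AllPairs using ([]; _∷_)
open import Data.List.Relation.Unary.Unique.Propositional using (Unique)
open import Data.Nat using (ℕ; zero; suc; _+_; _*_; _<_; _≤_; z≤n; s≤s)
import Data.Nat as ℕ
open import Data.Nat.Divisibility using (_∣_; m∣m*n; _∣0; ∣m∣n⇒∣m+n; ∣m+n∣m⇒∣n; ∣1⇒≡1)
open import Data.Nat.Induction using (<-wellFounded)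
import Data.Nat.ListAction as List
open import Data.Nat.Properties
open import Data.Nat.Solver using (module +-*-Solver)
open import Data.Product using (∃; ∃₂; _×_; _,_; proj₁; proj₂)
open import Data.Sum using (_⊎_; inj₁; inj₂)
open import Data.Unit using (⊤)
open import Function using (_∘_)
open import Induction.WellFounded using (Acc; acc)
open import Relation.Binary.Construct.Closure.ReflexiveTransitive using (Star; ε; _◅_; _◅◅_)
open import Relation.Binary.Definitions using (Decidable; DecidableEquality)
open import Relation.Binary.PropositionalEquality
open import Relation.Nullary using (Dec; yes; no; ¬_; contradiction)
open import Relation.Nullary.Decidable using (⌊_⌋; _×-dec_; _⊎-dec_; ¬?)

open import Algebra.Properties.Semiring.Sum +-*-semiring
  using (sum; sum-syntax; ∑-comm; ∑-distrib-+; *-distribˡ-sum; sum-cong-≗; sum-remove; sum-replicate-zero)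
open +-*-Solver using (solve; _:*_; _:=_)

module _ {A : Set} (_≟_ : DecidableEquality A) where

  ⌊≟⌋-refl : ∀ x → ⌊ x ≟ x ⌋ ≡ true
  ⌊≟⌋-refl x = cong ⌊_⌋ (≡-≟-identity _≟_ refl)

  ⌊≟⌋-≢ : ∀ {x y} → x ≢ y → ⌊ x ≟ y ⌋ ≡ false
  ⌊≟⌋-≢ x≢y = cong ⌊_⌋ (≢-≟-identity _≟_ x≢y)

  ⌊≟⌋-sound : ∀ {x y} → ⌊ x ≟ y ⌋ ≡ true → x ≡ y
  ⌊≟⌋-sound {x} {y} x≟y with yes x≡y ← x ≟ y = x≡y

∧-true⁻ : ∀ {a b} → a ∧ b ≡ true → a ≡ true × b ≡ true
∧-true⁻ {true} b≡true = refl , b≡true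

χ : Bool → ℕ
χ b = if b then 1 else 0

χ-mono : ∀ {p q} → (p ≡ true → q ≡ true) → χ p ≤ χ q
χ-mono {false}         p⇒q = z≤n
χ-mono {true}  {true}  p⇒q = ≤-refl
χ-mono {true}  {false} p⇒q with () ← p⇒q refl

χ-guarded-cong : ∀ {s} b {m m′} → (s ≡ true → m ≡ m′) → χ (s ∧ b) * m ≡ χ (s ∧ b) * m′
χ-guarded-cong {false} b _    = refl
χ-guarded-cong {true}  b m≡m′ = cong (χ b *_) (m≡m′ refl)

χ-split : ∀ p s q → χ (p ∧ q) ≡ χ p * χ (s ∧ q) + χ (p ∧ not s ∧ q)
χ-split false s     q     = refl
χ-split true  true  true  = refl
χ-split true  true  false = refl
χ-split true  false true  = refl
χ-split true  false false = refl

count≡∑ : ∀ {k} (p : Fin k → Bool) → count p ≡ ∑[ i < k ] χ (p i)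
count≡∑ {zero} p = refl
count≡∑ {suc k} p = cong (χ (p zero) +_) (begin
  List.sum (map (χ ∘ p) (tabulate suc))    ≡⟨ cong List.sum (map-tabulate suc (χ ∘ p)) ⟩
  List.sum (tabulate (χ ∘ p ∘ suc))        ≡⟨ cong List.sum (map-tabulate (λ i → i) (χ ∘ p ∘ suc)) ⟨
  count (p ∘ suc)                          ≡⟨ count≡∑ (p ∘ suc) ⟩
  ∑[ i < k ] χ (p (suc i))                 ∎)
  where open ≡-Reasoning

∑-mono-≤ : ∀ {k} {f g : Fin k → ℕ} → (∀ i → f i ≤ g i) → ∑[ i < k ] f i ≤ ∑[ i < k ] g i
∑-mono-≤ {zero}  f≤g = z≤n
∑-mono-≤ {suc k} f≤g = +-mono-≤ (f≤g zero) (∑-mono-≤ (f≤g ∘ suc))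

∑-mono-< : ∀ {k} {f g : Fin k → ℕ} → (∀ i → f i ≤ g i) → ∀ x → f x < g x →
           ∑[ i < k ] f i < ∑[ i < k ] g i
∑-mono-< f≤g zero    fx<gx = +-mono-<-≤ fx<gx (∑-mono-≤ (f≤g ∘ suc))
∑-mono-< f≤g (suc x) fx<gx = +-mono-≤-< (f≤g zero) (∑-mono-< (f≤g ∘ suc) x fx<gx)

∑-point : ∀ {k} (f : Fin k → ℕ) x → (∀ i → i ≢ x → f i ≡ 0) → ∑[ i < k ] f i ≡ f x
∑-point {suc k} f x vanishes = begin
  sum f                             ≡⟨ sum-remove {i = x} f ⟩
  f x + ∑[ j < k ] f (punchIn x j)  ≡⟨ cong (f x +_) (sum-cong-≗ λ j → vanishes (punchIn x j) (punchInᵢ≢i x j)) ⟩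
  f x + ∑[ j < k ] 0                ≡⟨ cong (f x +_) (sum-replicate-zero k) ⟩
  f x + 0                           ≡⟨ +-identityʳ (f x) ⟩
  f x                               ∎
  where open ≡-Reasoning

∑∑-symmetric-even : ∀ {k} (f : Fin k → Fin k → ℕ) →
                    (∀ i j → f i j ≡ f j i) → (∀ i → f i i ≡ 0) → 2 ∣ ∑[ i < k ] ∑[ j < k ] f i j
∑∑-symmetric-even {zero}  f symmetric diagonal = 2 ∣0
∑∑-symmetric-even {suc k} f symmetric diagonal =
  subst (2 ∣_) (sym split) (∣m∣n⇒∣m+n row+row-even rest-even)
  where
  open ≡-Reasoning
  row  = ∑[ j < k ] f zero (suc j)
  rest = ∑[ i < k ] ∑[ j < k ] f (suc i) (suc j)
  row+row-even = subst (2 ∣_) (cong (row +_) (+-identityʳ row)) (m∣m*n row)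
  rest-even = ∑∑-symmetric-even (λ i j → f (suc i) (suc j)) (λ i j → symmetric (suc i) (suc j))
                                (diagonal ∘ suc)
  split : ∑[ i < suc k ] ∑[ j < suc k ] f i j ≡ (row + row) + rest
  split = begin
    (f zero zero + row) + ∑[ i < k ] (f (suc i) zero + ∑[ j < k ] f (suc i) (suc j))
      ≡⟨ cong₂ _+_ (cong (_+ row) (diagonal zero)) (∑-distrib-+ (λ i → f (suc i) zero) _) ⟩
    row + (∑[ i < k ] f (suc i) zero + rest)
      ≡⟨ cong (λ column → row + (column + rest)) (sum-cong-≗ (λ i → symmetric (suc i) zero)) ⟩
    row + (row + rest)
      ≡⟨ +-assoc row row rest ⟨
    (row + row) + rest ∎

count-mono-< : ∀ {k} {p q : Fin k → Bool} → (∀ i → p i ≡ true → q i ≡ true) →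
               ∀ x → p x ≡ false → q x ≡ true → count p < count q
count-mono-< {p = p} {q} p⊆q x px qx
  rewrite count≡∑ p | count≡∑ q =
  ∑-mono-< (λ i → χ-mono (p⊆q i)) x (subst₂ (λ a b → χ a < χ b) (sym px) (sym qx) ≤-refl)

count≤size : ∀ {k} (p : Fin k → Bool) → count p ≤ k
count≤size {k} p rewrite count≡∑ p =
  ≤-trans (∑-mono-≤ (λ i → χ-mono {p i} {true} (λ _ → refl))) (≤-reflexive (∑1≡size k))
  where
  ∑1≡size : ∀ k → ∑[ i < k ] 1 ≡ k
  ∑1≡size zero    = refl
  ∑1≡size (suc k) = cong suc (∑1≡size k)

count-witness : ∀ {k} (p : Fin k → Bool) → 0 < count p → ∃ λ i → p i ≡ true
count-witness {k} p 0<count with any? (λ i → p i Bool.≟ true)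
... | yes witness = witness
... | no none     = contradiction (trans (count≡∑ p) all-zero) (>⇒≢ 0<count)
  where
  all-zero = trans (sum-cong-≗ (λ i → cong χ (Bool.¬-not (λ pi → none (i , pi))))) (sum-replicate-zero k)

unique⇒length≤count : ∀ {k} (p : Fin k → Bool) {xs} → Unique xs → All (λ x → p x ≡ true) xs →
                      length xs ≤ count p
unique⇒length≤count p {[]}     []                []         = z≤n
unique⇒length≤count p {x ∷ xs} (x∉xs ∷ xs-unique) (px ∷ pxs) =
  ≤-trans (s≤s (unique⇒length≤count p∖x xs-unique (All.zipWith kept (x∉xs , pxs))))
          (count-mono-< (λ i → proj₁ ∘ ∧-true⁻) x removed px)
  where
  p∖x : Fin _ → Bool
  p∖x i = p i ∧ not ⌊ i ≟ᶠ x ⌋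
  removed : p∖x x ≡ false
  removed rewrite ⌊≟⌋-refl _≟ᶠ_ x = Bool.∧-zeroʳ (p x)
  kept : ∀ {y} → x ≢ y × p y ≡ true → p∖x y ≡ true
  kept (x≢y , py) rewrite py | ⌊≟⌋-≢ _≟ᶠ_ (x≢y ∘ sym) = refl

module Reachability {k} {_⇒_ : Fin k → Fin k → Set} (_⇒?_ : Decidable _⇒_) where

  record ReachableSet (a : Fin k) : Set where
    field
      member    : Fin k → Bool
      source    : member a ≡ true
      closed    : ∀ {y z} → member y ≡ true → y ⇒ z → member z ≡ true
      reachable : ∀ {x} → member x ≡ true → Star _⇒_ a x

  private
    Exit : (Fin k → Bool) → Set
    Exit R = ∃₂ λ y z → R y ≡ true × y ⇒ z × R z ≡ false

    exit? : ∀ R → Dec (Exit R)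
    exit? R = any? λ y → any? λ z → (R y Bool.≟ true) ×-dec (y ⇒? z) ×-dec (R z Bool.≟ false)

    grow : ∀ {a} (R : Fin k → Bool) → Acc _<_ (count (not ∘ R)) → R a ≡ true →
           (∀ {x} → R x ≡ true → Star _⇒_ a x) → ReachableSet a
    grow R _ Ra reach with exit? R
    ... | no no-exit = record { member = R ; source = Ra ; closed = closed ; reachable = reach }
      where
      closed : ∀ {y z} → R y ≡ true → y ⇒ z → R z ≡ true
      closed {y} {z} Ry y⇒z = Bool.¬-not (λ Rz≡false → no-exit (y , z , Ry , y⇒z , Rz≡false))
    grow {a} R (acc smaller) Ra reach | yes (y , z , Ry , y⇒z , Rz) =
      grow R′ (smaller fewer-outside) (cong (_∨ _) Ra) reach′
      where
      R′ : Fin k → Bool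
      R′ x = R x ∨ ⌊ x ≟ᶠ z ⌋
      fewer-outside : count (not ∘ R′) < count (not ∘ R)
      fewer-outside = count-mono-< outside-shrinks z z-added (cong not Rz)
        where
        outside-shrinks : ∀ x → not (R′ x) ≡ true → not (R x) ≡ true
        outside-shrinks x with R x
        ... | false = λ _ → refl
        z-added : not (R′ z) ≡ false
        z-added rewrite ⌊≟⌋-refl _≟ᶠ_ z = cong not (Bool.∨-zeroʳ (R z))
      reach′ : ∀ {x} → R′ x ≡ true → Star _⇒_ a x
      reach′ {x} R′x with R x in Rx | x ≟ᶠ z
      ... | true  | _        = reach Rx
      ... | false | yes refl = reach Ry ◅◅ (y⇒z ◅ ε)

  reachable-set : ∀ a → ReachableSet a
  reachable-set a = grow (λ x → ⌊ x ≟ᶠ a ⌋) (<-wellFounded _) (⌊≟⌋-refl _≟ᶠ_ a) reach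
    where
    reach : ∀ {x} → ⌊ x ≟ᶠ a ⌋ ≡ true → Star _⇒_ a x
    reach x≟a rewrite ⌊≟⌋-sound _≟ᶠ_ x≟a = ε

adj-flip : ∀ G {u w} → adj G u w ≡ true → adj G w u ≡ true
adj-flip G {u} {w} uw = trans (adj-sym G w u) uw

module _ {G : Graph} {P : Fin (n G) → Set} where

  walk-start : ∀ {u w} → Walk G P u w → P u
  walk-start (here pu)     = pu
  walk-start (step pu _ _) = pu

  walk-end : ∀ {u w} → Walk G P u w → P w
  walk-end (here pw)    = pw
  walk-end (step _ _ p) = walk-end p

  _++ʷ_ : ∀ {u v w} → Walk G P u v → Walk G P v w → Walk G P u w
  here _       ++ʷ q = q
  step pu uv p ++ʷ q = step pu uv (p ++ʷ q)

  reverseʷ : ∀ {u w} → Walk G P u w → Walk G P w u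
  reverseʷ (here pu) = here pu
  reverseʷ (step pu uv p) = reverseʷ p ++ʷ step (walk-start p) (adj-flip G uv) (here pu)

  star⇒walk : ∀ {u w} → P u → Star (λ x y → adj G x y ≡ true × P y) u w → Walk G P u w
  star⇒walk pu ε                  = here pu
  star⇒walk pu ((uv , pv) ◅ rest) = step pu uv (star⇒walk pv rest)

neighbours≤3 : ∀ G → Cubic G → ∀ {u xs} → Unique xs → All (λ x → adj G u x ≡ true) xs →
               length xs ≤ 3
neighbours≤3 G cubic {u} distinct adjacent =
  subst (_ ≤_) (cubic u) (unique⇒length≤count (adj G u) distinct adjacent)

cubic⇒2<size : ∀ G → Cubic G → 0 < n G → 2 < n G
cubic⇒2<size G cubic 0<n = subst (_≤ n G) (cubic u) (count≤size (adj G u))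
  where u = fromℕ< 0<n

record Bridge (G : Graph) (S : Fin (n G) → Bool) (a v : Fin (n G)) : Set where
  field
    inside     : S a ≡ true
    outside    : S v ≡ false
    edge       : adj G a v ≡ true
    only-exit  : ∀ {y z} → S y ≡ true → adj G y z ≡ true → S z ≡ false → y ≡ a × z ≡ v

module PerfectColouring (G : Graph) (c : Fin (n G) → ℕ) {c₁ c₂ c₃ : ℕ}
  (c₁≢c₂ : c₁ ≢ c₂) (c₁≢c₃ : c₁ ≢ c₃) (c₂≢c₃ : c₂ ≢ c₃)
  (one-of-each : ∀ v → colNbrs G c v c₁ ≡ 1 × colNbrs G c v c₂ ≡ 1 × colNbrs G c v c₃ ≡ 1) where

  Palette : ℕ → Set
  Palette X = X ≡ c₁ ⊎ X ≡ c₂ ⊎ X ≡ c₃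

  pattern colour₁ = inj₁ refl
  pattern colour₂ = inj₂ (inj₁ refl)
  pattern colour₃ = inj₂ (inj₂ refl)

  palette? : ∀ X → Dec (Palette X)
  palette? X = X ℕ.≟ c₁ ⊎-dec X ℕ.≟ c₂ ⊎-dec X ℕ.≟ c₃

  one-neighbour : ∀ {X} → Palette X → ∀ v → colNbrs G c v X ≡ 1
  one-neighbour colour₁ v = proj₁ (one-of-each v)
  one-neighbour colour₂ v = proj₁ (proj₂ (one-of-each v))
  one-neighbour colour₃ v = proj₂ (proj₂ (one-of-each v))

  third-colour : ∀ {A B} → Palette A → Palette B → ∃ λ C → Palette C × C ≢ A × C ≢ B
  third-colour colour₁ colour₁ = c₂ , colour₂ , c₁≢c₂ ∘ sym , c₁≢c₂ ∘ sym
  third-colour colour₁ colour₂ = c₃ , colour₃ , c₁≢c₃ ∘ sym , c₂≢c₃ ∘ sym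
  third-colour colour₁ colour₃ = c₂ , colour₂ , c₁≢c₂ ∘ sym , c₂≢c₃
  third-colour colour₂ colour₁ = c₃ , colour₃ , c₂≢c₃ ∘ sym , c₁≢c₃ ∘ sym
  third-colour colour₂ colour₂ = c₁ , colour₁ , c₁≢c₂ , c₁≢c₂
  third-colour colour₂ colour₃ = c₁ , colour₁ , c₁≢c₂ , c₁≢c₃
  third-colour colour₃ colour₁ = c₂ , colour₂ , c₂≢c₃ , c₁≢c₂ ∘ sym
  third-colour colour₃ colour₂ = c₁ , colour₁ , c₁≢c₃ , c₁≢c₂
  third-colour colour₃ colour₃ = c₁ , colour₁ , c₁≢c₃ , c₁≢c₃

  coloured-neighbour : ∀ {X} → Palette X → ∀ u → ∃ λ x → adj G u x ≡ true × c x ≡ X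
  coloured-neighbour pX u with count-witness _ (≤-reflexive (sym (one-neighbour pX u)))
  ... | x , hit with ∧-true⁻ hit
  ... | ux , cx = x , ux , ⌊≟⌋-sound ℕ._≟_ cx

  neighbour-colour-in-palette : Cubic G → ∀ {u w} → adj G u w ≡ true → Palette (c w)
  neighbour-colour-in-palette cubic {u} {w} uw
    with palette? (c w)
       | coloured-neighbour colour₁ u | coloured-neighbour colour₂ u | coloured-neighbour colour₃ u
  ... | yes pw | _ | _ | _ = pw
  ... | no ¬pw | x₁ , ux₁ , cx₁ | x₂ , ux₂ , cx₂ | x₃ , ux₃ , cx₃ =
    contradiction (neighbours≤3 G cubic distinct (uw ∷ ux₁ ∷ ux₂ ∷ ux₃ ∷ [])) 1+n≰n
    where
    colours-differ : ∀ {x y} → c x ≢ c y → x ≢ y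
    colours-differ cx≢cy = cx≢cy ∘ cong c
    distinct : Unique (w ∷ x₁ ∷ x₂ ∷ x₃ ∷ [])
    distinct = (colours-differ (λ e → ¬pw (inj₁ (trans e cx₁))) ∷
                colours-differ (λ e → ¬pw (inj₂ (inj₁ (trans e cx₂)))) ∷
                colours-differ (λ e → ¬pw (inj₂ (inj₂ (trans e cx₃)))) ∷ []) ∷
               (colours-differ (λ e → c₁≢c₂ (trans (sym cx₁) (trans e cx₂))) ∷
                colours-differ (λ e → c₁≢c₃ (trans (sym cx₁) (trans e cx₃))) ∷ []) ∷
               (colours-differ (λ e → c₂≢c₃ (trans (sym cx₂) (trans e cx₃))) ∷ []) ∷ [] ∷ []

  -- With C a third colour, N A = N B = N C = M C C is even, whereas N A = M A A + 1 if A = B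
  -- and N A = N B + 1 otherwise.
  crossing-counts-impossible : ∀ {A B} → Palette A → Palette B → (M : ℕ → ℕ → ℕ) (N : ℕ → ℕ) →
    (∀ X Y → M X Y ≡ M Y X) → (∀ X → 2 ∣ M X X) →
    (∀ {X Y} → Palette X → X ≢ B ⊎ Y ≢ A → M X Y ≡ N Y) → M B A + 1 ≡ N A → ⊥
  crossing-counts-impossible {A} {B} pA pB M N M-sym M-even uncrossed crossed
    with C , pC , C≢A , C≢B ← third-colour pA pB = by-cases (A ℕ.≟ B)
    where
    NA≡NC : N A ≡ N C
    NA≡NC = trans (sym (uncrossed pC (inj₁ C≢B))) (trans (M-sym C A) (uncrossed pA (inj₂ C≢A)))
    NB≡NC : N B ≡ N C
    NB≡NC = trans (sym (uncrossed pC (inj₁ C≢B))) (trans (M-sym C B) (uncrossed pB (inj₂ C≢A)))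
    NC-even : 2 ∣ N C
    NC-even = subst (2 ∣_) (uncrossed pC (inj₁ C≢B)) (M-even C)
    by-cases : Dec (A ≡ B) → ⊥
    by-cases (yes refl) = contradiction (∣1⇒≡1 (∣m+n∣m⇒∣n NA-even (M-even A))) λ ()
      where
      NA-even : 2 ∣ M A A + 1
      NA-even = subst (2 ∣_) (sym (trans crossed NA≡NC)) NC-even
    by-cases (no A≢B) = m+1+n≢m (N B) (trans (sym NA≡NB+1) (trans NA≡NC (sym NB≡NC)))
      where
      NA≡NB+1 : N A ≡ N B + 1
      NA≡NB+1 = trans (sym crossed) (cong (_+ 1) (trans (M-sym B A) (uncrossed pA (inj₁ A≢B))))

  module BridgeCounting {S : Fin (n G) → Bool} {a v} (bridge : Bridge G S a v) where
    open Bridge bridge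

    inS : ℕ → Fin (n G) → ℕ
    inS X z = χ (S z ∧ ⌊ c z ℕ.≟ X ⌋)

    inner-nbr outer-nbr : ℕ → Fin (n G) → Fin (n G) → ℕ
    inner-nbr X y z = χ (adj G y z) * inS X z
    outer-nbr X y z = χ (adj G y z ∧ not (S z) ∧ ⌊ c z ℕ.≟ X ⌋)

    crossing : ℕ → Fin (n G) → ℕ
    crossing X y = χ (adj G y v ∧ ⌊ c v ℕ.≟ X ⌋)

    inner-edge : ℕ → ℕ → Fin (n G) → Fin (n G) → ℕ
    inner-edge X Y y z = inS Y y * inner-nbr X y z

    N : ℕ → ℕ
    N Y = ∑[ y < n G ] inS Y y

    M : ℕ → ℕ → ℕ
    M X Y = ∑[ y < n G ] ∑[ z < n G ] inner-edge X Y y z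

    inner-edge-swap : ∀ X Y y z → inner-edge X Y y z ≡ inner-edge Y X z y
    inner-edge-swap X Y y z rewrite adj-sym G y z =
      solve 3 (λ s e t → s :* (e :* t) := t :* (e :* s)) refl (inS Y y) (χ (adj G z y)) (inS X z)

    M-sym : ∀ X Y → M X Y ≡ M Y X
    M-sym X Y = trans (∑-comm (inner-edge X Y)) (sum-cong-≗ λ z → sum-cong-≗ λ y → inner-edge-swap X Y y z)

    M-even : ∀ X → 2 ∣ M X X
    M-even X = ∑∑-symmetric-even (inner-edge X X) (inner-edge-swap X X) loopless
      where
      loopless : ∀ y → inner-edge X X y y ≡ 0
      loopless y rewrite irrefl G y = *-zeroʳ (inS X y)

    outer-nbrs≡crossing : ∀ X {y} → S y ≡ true → ∑[ z < n G ] outer-nbr X y z ≡ crossing X y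
    outer-nbrs≡crossing X {y} Sy = trans (∑-point (outer-nbr X y) v only-v) at-v
      where
      only-v : ∀ z → z ≢ v → outer-nbr X y z ≡ 0
      only-v z z≢v with adj G y z in yz | S z in Sz
      ... | false | _     = refl
      ... | true  | true  = refl
      ... | true  | false = contradiction (proj₂ (only-exit Sy yz Sz)) z≢v
      at-v : outer-nbr X y v ≡ crossing X y
      at-v rewrite outside = refl

    colNbrs-inside : ∀ X {y} → S y ≡ true → colNbrs G c y X ≡ ∑[ z < n G ] inner-nbr X y z + crossing X y
    colNbrs-inside X {y} Sy = begin
      colNbrs G c y X
        ≡⟨ count≡∑ (λ z → adj G y z ∧ ⌊ c z ℕ.≟ X ⌋) ⟩
      ∑[ z < n G ] χ (adj G y z ∧ ⌊ c z ℕ.≟ X ⌋)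
        ≡⟨ sum-cong-≗ (λ z → χ-split (adj G y z) (S z) _) ⟩
      ∑[ z < n G ] (inner-nbr X y z + outer-nbr X y z)
        ≡⟨ ∑-distrib-+ (inner-nbr X y) (outer-nbr X y) ⟩
      ∑[ z < n G ] inner-nbr X y z + ∑[ z < n G ] outer-nbr X y z
        ≡⟨ cong (∑[ z < n G ] inner-nbr X y z +_) (outer-nbrs≡crossing X Sy) ⟩
      ∑[ z < n G ] inner-nbr X y z + crossing X y ∎
      where open ≡-Reasoning

    crossing-edges : ∀ X Y →
      ∑[ y < n G ] (inS Y y * crossing X y) ≡ χ ⌊ c a ℕ.≟ Y ⌋ * χ ⌊ c v ℕ.≟ X ⌋
    crossing-edges X Y = trans (∑-point (λ y → inS Y y * crossing X y) a only-a) at-a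
      where
      only-a : ∀ y → y ≢ a → inS Y y * crossing X y ≡ 0
      only-a y y≢a with S y in Sy | adj G y v in yv
      ... | false | _     = refl
      ... | true  | false = *-zeroʳ (χ ⌊ c y ℕ.≟ Y ⌋)
      ... | true  | true  = contradiction (proj₁ (only-exit Sy yv outside)) y≢a
      at-a : inS Y a * crossing X a ≡ χ ⌊ c a ℕ.≟ Y ⌋ * χ ⌊ c v ℕ.≟ X ⌋
      at-a rewrite inside | edge = refl

    edge-count : ∀ {X} → Palette X → ∀ Y → M X Y + χ ⌊ c a ℕ.≟ Y ⌋ * χ ⌊ c v ℕ.≟ X ⌋ ≡ N Y
    edge-count {X} pX Y = begin
      M X Y + χ ⌊ c a ℕ.≟ Y ⌋ * χ ⌊ c v ℕ.≟ X ⌋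
        ≡⟨ cong₂ _+_ (sum-cong-≗ λ y → *-distribˡ-sum (inS Y y) (inner-nbr X y)) (crossing-edges X Y) ⟨
      ∑[ y < n G ] (inS Y y * inner-nbrs y) + ∑[ y < n G ] (inS Y y * crossing X y)
        ≡⟨ ∑-distrib-+ (λ y → inS Y y * inner-nbrs y) (λ y → inS Y y * crossing X y) ⟨
      ∑[ y < n G ] (inS Y y * inner-nbrs y + inS Y y * crossing X y)
        ≡⟨ sum-cong-≗ weighted-row ⟨
      ∑[ y < n G ] (inS Y y * colNbrs G c y X)
        ≡⟨ sum-cong-≗ (λ y → trans (cong (inS Y y *_) (one-neighbour pX y)) (*-identityʳ (inS Y y))) ⟩
      N Y ∎
      where
      open ≡-Reasoning
      inner-nbrs : Fin (n G) → ℕ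
      inner-nbrs y = ∑[ z < n G ] inner-nbr X y z
      weighted-row : ∀ y → inS Y y * colNbrs G c y X ≡ inS Y y * inner-nbrs y + inS Y y * crossing X y
      weighted-row y = trans (χ-guarded-cong _ (colNbrs-inside X)) (*-distribˡ-+ (inS Y y) _ _)

    edge-count-off-bridge : ∀ {X Y} → Palette X → X ≢ c v ⊎ Y ≢ c a → M X Y ≡ N Y
    edge-count-off-bridge {X} {Y} pX off = begin
      M X Y                                              ≡⟨ +-identityʳ (M X Y) ⟨
      M X Y + 0                                          ≡⟨ cong (M X Y +_) (no-crossing off) ⟨
      M X Y + χ ⌊ c a ℕ.≟ Y ⌋ * χ ⌊ c v ℕ.≟ X ⌋          ≡⟨ edge-count pX Y ⟩
      N Y                                                ∎
      where
      open ≡-Reasoning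
      no-crossing : X ≢ c v ⊎ Y ≢ c a → χ ⌊ c a ℕ.≟ Y ⌋ * χ ⌊ c v ℕ.≟ X ⌋ ≡ 0
      no-crossing (inj₁ X≢cv) rewrite ⌊≟⌋-≢ ℕ._≟_ (X≢cv ∘ sym) = *-zeroʳ (χ ⌊ c a ℕ.≟ Y ⌋)
      no-crossing (inj₂ Y≢ca) rewrite ⌊≟⌋-≢ ℕ._≟_ (Y≢ca ∘ sym) = refl

    edge-count-across-bridge : Palette (c v) → M (c v) (c a) + 1 ≡ N (c a)
    edge-count-across-bridge pv
      with edge-count pv (c a)
    ... | count-identity rewrite ⌊≟⌋-refl ℕ._≟_ (c a) | ⌊≟⌋-refl ℕ._≟_ (c v) = count-identity

    impossible : Palette (c a) → Palette (c v) → ⊥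
    impossible pa pv = crossing-counts-impossible pa pv M N M-sym M-even edge-count-off-bridge
                                                  (edge-count-across-bridge pv)

  bridgeless : Cubic G → ∀ {S a v} → ¬ Bridge G S a v
  bridgeless cubic bridge = BridgeCounting.impossible bridge (neighbour-colour-in-palette cubic (adj-flip G edge))
                                                             (neighbour-colour-in-palette cubic edge)
    where open Bridge bridge

adj⇒≢ : ∀ G {u w} → adj G u w ≡ true → u ≢ w
adj⇒≢ G {u} uw refl with () ← trans (sym uw) (irrefl G u)

module CubicBridgeless (G : Graph) (cubic : Cubic G) (bridgeless : ∀ {S a v} → ¬ Bridge G S a v)
                       (v : Fin (n G)) where

  StepAvoiding : Fin (n G) → Fin (n G) → Set
  StepAvoiding y z = adj G y z ≡ true × z ≢ v

  step-avoiding? : Decidable StepAvoiding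
  step-avoiding? y z = (adj G y z Bool.≟ true) ×-dec ¬? (z ≟ᶠ v)

  open Reachability step-avoiding?

  component : Fin (n G) → Fin (n G) → Bool
  component a = ReachableSet.member (reachable-set a)

  walk-in-component : ∀ {a x} → a ≢ v → component a x ≡ true → Walk G (_≢ v) a x
  walk-in-component {a} a≢v = star⇒walk a≢v ∘ ReachableSet.reachable (reachable-set a)

  neighbour≢v : ∀ {x} → adj G v x ≡ true → x ≢ v
  neighbour≢v vx = adj⇒≢ G vx ∘ sym

  separated : ∀ {a x y} → component a x ≡ true → component a y ≡ false → x ≢ y
  separated ax ay refl with () ← trans (sym ax) ay

  second-neighbour : ∀ {a} → adj G a v ≡ true →
                     ∃ λ z → component a z ≡ true × adj G z v ≡ true × z ≢ a
  second-neighbour {a} av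
    with any? (λ z → (component a z Bool.≟ true) ×-dec (adj G z v Bool.≟ true) ×-dec ¬? (z ≟ᶠ a))
  ... | yes found = found
  ... | no none   = contradiction bridge bridgeless
    where
    open ReachableSet (reachable-set a)
    a≢v = adj⇒≢ G av
    only-exit : ∀ {y z} → member y ≡ true → adj G y z ≡ true → member z ≡ false → y ≡ a × z ≡ v
    only-exit {y} {z} Sy yz Sz with z ≟ᶠ v | y ≟ᶠ a
    ... | no z≢v  | _        = contradiction (trans (sym (closed Sy (yz , z≢v))) Sz) λ ()
    ... | yes refl | yes y≡a = y≡a , refl
    ... | yes refl | no y≢a  = contradiction (y , Sy , yz , y≢a) none
    bridge : Bridge G member a v
    bridge = record
      { inside    = source
      ; outside   = Bool.¬-not (λ Sv → walk-end (walk-in-component a≢v Sv) refl)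
      ; edge      = av
      ; only-exit = only-exit
      }

  neighbours-connected : ∀ {x y} → adj G v x ≡ true → adj G v y ≡ true → Walk G (_≢ v) x y
  neighbours-connected {x} {y} vx vy with component x y in Sxy
  ... | true  = walk-in-component (neighbour≢v vx) Sxy
  ... | false
    with z , Sxz , zv , z≢x ← second-neighbour (adj-flip G vx)
       | t , Syt , tv , t≢y ← second-neighbour (adj-flip G vy)
       | component x t in Sxt
  ...   | true  = walk-in-component (neighbour≢v vx) Sxt ++ʷ reverseʷ (walk-in-component (neighbour≢v vy) Syt)
  ...   | false =
    contradiction (neighbours≤3 G cubic distinct (vx ∷ vy ∷ adj-flip G zv ∷ adj-flip G tv ∷ [])) 1+n≰n
    where
    Sxx = ReachableSet.source (reachable-set x)
    distinct : Unique (x ∷ y ∷ z ∷ t ∷ [])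
    distinct = (separated Sxx Sxy ∷ z≢x ∘ sym ∷ separated Sxx Sxt ∷ []) ∷
               (separated Sxz Sxy ∘ sym ∷ t≢y ∘ sym ∷ []) ∷
               (separated Sxz Sxt ∷ []) ∷ [] ∷ []

  detour : ∀ {u w} → u ≢ v → w ≢ v → Walk G (λ _ → ⊤) u w → Walk G (_≢ v) u w
  detour-via-v : ∀ {u w} → adj G u v ≡ true → w ≢ v → Walk G (λ _ → ⊤) v w → Walk G (_≢ v) u w

  detour u≢v w≢v (here _) = here u≢v
  detour u≢v w≢v (step {v = x} _ ux p) with x ≟ᶠ v
  ... | no x≢v   = step u≢v ux (detour x≢v w≢v p)
  ... | yes refl = detour-via-v ux w≢v p

  detour-via-v uv w≢v (here _)      = contradiction refl w≢v
  detour-via-v uv w≢v (step _ vy p) = neighbours-connected (adj-flip G uv) vy ++ʷ detour (neighbour≢v vy) w≢v p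

cubic-bridgeless⇒2-connected : ∀ G → Cubic G → Connected G → (∀ {S a v} → ¬ Bridge G S a v) →
                               TwoConnected G
cubic-bridgeless⇒2-connected G cubic (0<n , connected) bridgeless =
  cubic⇒2<size G cubic 0<n ,
  λ v u w u≢v w≢v → CubicBridgeless.detour G cubic bridgeless v u≢v w≢v (connected u w)

lemma5p6 : (G : Graph) → InA111 G → TwoConnected G
lemma5p6 G (connected , _ , cubic , c , _ , _ , _ , c₁≢c₂ , c₁≢c₃ , c₂≢c₃ , one-of-each) =
  cubic-bridgeless⇒2-connected G cubic connected
    (PerfectColouring.bridgeless G c c₁≢c₂ c₁≢c₃ c₂≢c₃ one-of-each cubic)
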